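{- Let $f$ be the morphism on $\{0,1,2\}^*$ defined by $f(0)=012\,021\,201\,021\,012\,102\,120\,210$, $f(1)=120\,102\,012\,102\,120\,210\,201\,021$, $f(2)=201\,210\,120\,210\,201\,021\,012\,102$ (each image has length $24$; spaces are only for readability), and let $f^\omega(0)$ be its infinite fixed point beginning with $0$. Then $f^\omega(0)$ is undirected $\tfrac{7}{4}^+$-free.
   Context: For a word $x=x_1\cdots x_n$ (letters $x_i$), its reversal is $x^R=x_n\cdots x_1$. For rational $1<r\leq 2$, an undirected $r$-power is a word $xyx'$ with $x$ nonempty, $x'\in\{x,x^R\}$, and $|xyx'|/|xy|=r$. A word is undirected $\alpha^+$-free if none of its factors is an undirected $r$-power for any rational $r>\alpha$. -}

module Defs where

open import Data.Nat using (ℕ; zero; suc; _+_; _*_; _^_; _<_; _≤_; _>_)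
open import Data.Fin using (Fin; zero; suc)
open import Data.List using (List; []; _∷_; _++_; concatMap; length; reverse; drop; take)
open import Data.Maybe using (Maybe; just; nothing)
open import Data.Product using (Σ; ∃; _×_; _,_)
open import Data.Sum using (_⊎_)
open import Data.Empty using (⊥)
open import Relation.Binary.PropositionalEquality using (_≡_)

Letter : Set
Letter = Fin 3

Word : Set
Word = List Letter

pattern a0 = zero
pattern a1 = suc zero
pattern a2 = suc (suc zero)

f-letter : Letter → Word
f-letter a0 = a0 ∷ a1 ∷ a2 ∷ a0 ∷ a2 ∷ a1 ∷ a2 ∷ a0 ∷ a1 ∷ a0 ∷ a2 ∷ a1 ∷ a0 ∷ a1 ∷ a2 ∷ a1 ∷ a0 ∷ a2 ∷ a1 ∷ a2 ∷ a0 ∷ a2 ∷ a1 ∷ a0 ∷ []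
f-letter a1 = a1 ∷ a2 ∷ a0 ∷ a1 ∷ a0 ∷ a2 ∷ a0 ∷ a1 ∷ a2 ∷ a1 ∷ a0 ∷ a2 ∷ a1 ∷ a2 ∷ a0 ∷ a2 ∷ a1 ∷ a0 ∷ a2 ∷ a0 ∷ a1 ∷ a0 ∷ a2 ∷ a1 ∷ []
f-letter a2 = a2 ∷ a0 ∷ a1 ∷ a2 ∷ a1 ∷ a0 ∷ a1 ∷ a2 ∷ a0 ∷ a2 ∷ a1 ∷ a0 ∷ a2 ∷ a0 ∷ a1 ∷ a0 ∷ a2 ∷ a1 ∷ a0 ∷ a1 ∷ a2 ∷ a1 ∷ a0 ∷ a2 ∷ []

f : Word → Word
f = concatMap f-letter

f^ : ℕ → Word → Word
f^ zero    w = w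
f^ (suc k) w = f (f^ k w)

-- Since f(0) begins with 0, f^k(0) is a prefix of f^(k+1)(0), and
-- f^ω(0) is the unique infinite word having every f^k(0) as a prefix.
-- As |f^(n+1)(0)| = 24^(n+1) > n, the n-th letter (0-indexed) of f^ω(0)
-- is the n-th letter of f^(n+1)(0).
lookupW : Word → ℕ → Letter
lookupW []       _       = a0   -- never used (index always in range)
lookupW (c ∷ _)  zero    = c
lookupW (_ ∷ cs) (suc n) = lookupW cs n

fω0 : ℕ → Letter
fω0 n = lookupW (f^ (suc n) (a0 ∷ [])) n

factorAt : (ℕ → Letter) → ℕ → ℕ → Word
factorAt w i zero    = []
factorAt w i (suc m) = w i ∷ factorAt w (suc i) m

IsFactor : Word → (ℕ → Letter) → Set
IsFactor u w = ∃ λ i → factorAt w i (length u) ≡ u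

-- u is an undirected r-power with r = num/den:
-- u = x y x' with x nonempty, x' ∈ {x, x^R}, and |xyx'| / |xy| = num/den
-- (the ratio equation is stated cross-multiplied: |xyx'| * den = num * |xy|).
IsUndirectedPower : Word → ℕ → ℕ → Set
IsUndirectedPower u num den =
  Σ Word λ x → Σ Word λ y → Σ Word λ x' →
    (0 < length x) × (x' ≡ x ⊎ x' ≡ reverse x) × (u ≡ x ++ y ++ x') ×
    (length u * den ≡ num * length (x ++ y))

-- w is undirected α⁺-free (α = a/b, b > 0): no factor is an undirected
-- r-power for a rational r = num/den (den > 0) with r > α, i.e. num*b > a*den.
UndirectedPlusFree : (ℕ → Letter) → ℕ → ℕ → Set
UndirectedPlusFree w a b =
  ∀ (u : Word) (num den : ℕ) → 0 < den → b * num > a * den →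
    IsFactor u w → IsUndirectedPower u num den → ⊥

module Submission where

-- The fixed point is the image of itself under the 24-uniform morphism f and has no two
-- equal adjacent letters, so every short factor lies inside f(ab) or f(abc) for consecutive,
-- distinct letters a, b, c of fω0; finitely many such windows carry all local information.
-- By inspecting them: repetitions x y x with |x| < 16 and x y xᴿ with |x| < 19 of exponent
-- greater than 7/4 do not occur, a factor of length 16 determines its position modulo 24,
-- every column of f is injective, and no factor of length 19 has its reversal as a factor.
-- The last fact excludes the long reversed repetitions. A long direct repetition is
-- synchronised, so its period is a multiple of 24 and column injectivity turns it into a
-- repetition with period divided by 24 and exponent still greater than 7/4; induction on
-- the period finishes the proof.

open import Defs
open import Data.Empty using (⊥)
open import Data.Fin.Properties using (all?) renaming (_≟_ to _≟ᴸ_)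
open import Data.List using ([]; _∷_; _++_; length; reverse)
open import Data.List.Properties using (length-++; ++-assoc; unfold-reverse; length-reverse; concatMap-++)
open import Data.Nat
open import Data.Nat.DivMod
open import Data.Nat.Divisibility using (_∣_; n∣m*n; ∣m+n∣m⇒∣n; ∣⇒≤)
open import Data.Nat.Induction using (<-rec)
open import Data.Nat.Properties
open import Data.Nat.Tactic.RingSolver using (solve-∀)
open import Data.Product using (∃; _×_; _,_)
open import Data.Sum using (_⊎_; inj₁; inj₂; [_,_]′)
open import Relation.Binary.PropositionalEquality hiding ([_])
open import Relation.Nullary using (¬_; yes; no)
open import Relation.Nullary.Decidable using (from-yes; ¬?; _→-dec_)

m≡n*[m/n]+m%n : ∀ m n .{{_ : NonZero n}} → m ≡ n * (m / n) + m % n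
m≡n*[m/n]+m%n m n = trans (m≡m%n+[m/n]*n m n) (trans (+-comm (m % n) _) (cong (_+ m % n) (*-comm (m / n) n)))

⌈_/_⌉ : ℕ → (n : ℕ) → .{{NonZero n}} → ℕ
⌈ zero  / n ⌉ = 0
⌈ suc m / n ⌉ = suc (m / n)

m≤n*⌈m/n⌉ : ∀ m n .{{_ : NonZero n}} → m ≤ n * ⌈ m / n ⌉
m≤n*⌈m/n⌉ zero    n = z≤n
m≤n*⌈m/n⌉ (suc m) n = begin
  suc m                    ≡⟨ cong suc (m≡m%n+[m/n]*n m n) ⟩
  suc (m % n + m / n * n)  ≤⟨ +-monoˡ-≤ (m / n * n) (m%n<n m n) ⟩
  n + m / n * n            ≡⟨ cong (n +_) (*-comm (m / n) n) ⟩
  n + n * (m / n)          ≡⟨ *-suc n (m / n) ⟨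
  n * suc (m / n)          ∎
  where open ≤-Reasoning

k<⌈m/n⌉⇒k*n<m : ∀ {m n k} .{{_ : NonZero n}} → k < ⌈ m / n ⌉ → k * n < m
k<⌈m/n⌉⇒k*n<m {suc m} {n} {k} (s≤s k≤m/n) = s≤s (≤-trans (*-monoˡ-≤ n k≤m/n) (m/n*n≤m m n))

a*p<b*e⇒a*[p/n]<b*⌈e/n⌉ : ∀ a b {p e n} .{{_ : NonZero n}} → n ∣ p → a * p < b * e → a * (p / n) < b * ⌈ e / n ⌉
a*p<b*e⇒a*[p/n]<b*⌈e/n⌉ a b {p} {e} {n} n∣p ap<be = *-cancelˡ-< n (a * (p / n)) (b * ⌈ e / n ⌉) (begin-strict
  n * (a * (p / n))    ≡⟨ x*[y*z]≡y*[x*z] n a (p / n) ⟩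
  a * (n * (p / n))    ≡⟨ cong (a *_) (m*[n/m]≡n n∣p) ⟩
  a * p                <⟨ ap<be ⟩
  b * e                ≤⟨ *-monoʳ-≤ b (m≤n*⌈m/n⌉ e n) ⟩
  b * (n * ⌈ e / n ⌉)  ≡⟨ x*[y*z]≡y*[x*z] b n ⌈ e / n ⌉ ⟩
  n * (b * ⌈ e / n ⌉)  ∎)
  where
  open ≤-Reasoning
  x*[y*z]≡y*[x*z] : ∀ x y z → x * (y * z) ≡ y * (x * z)
  x*[y*z]≡y*[x*z] = solve-∀

m%d≡[m+n]%d⇒d∣n : ∀ m n d .{{_ : NonZero d}} → m % d ≡ (m + n) % d → d ∣ n
m%d≡[m+n]%d⇒d∣n m n d m%d≡[m+n]%d = ∣m+n∣m⇒∣n d∣[m/d]*d+n (n∣m*n (m / d))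
  where
  open ≡-Reasoning
  [m/d]*d+n≡ : m / d * d + n ≡ (m + n) / d * d
  [m/d]*d+n≡ = +-cancelˡ-≡ (m % d) _ _ (begin
    m % d + (m / d * d + n)         ≡⟨ +-assoc (m % d) _ n ⟨
    m % d + m / d * d + n           ≡⟨ cong (_+ n) (m≡m%n+[m/n]*n m d) ⟨
    m + n                           ≡⟨ m≡m%n+[m/n]*n (m + n) d ⟩
    (m + n) % d + (m + n) / d * d   ≡⟨ cong (_+ (m + n) / d * d) m%d≡[m+n]%d ⟨
    m % d + (m + n) / d * d         ∎)
  d∣[m/d]*d+n : d ∣ m / d * d + n
  d∣[m/d]*d+n = subst (d ∣_) (sym [m/d]*d+n≡) (n∣m*n ((m + n) / d))

n*q+r<n*m : ∀ n {q r m} → q < m → r < n → n * q + r < n * m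
n*q+r<n*m n {q} {r} {m} q<m r<n = begin-strict
  n * q + r  <⟨ +-monoʳ-< (n * q) r<n ⟩
  n * q + n  ≡⟨ +-comm (n * q) n ⟩
  n + n * q  ≡⟨ *-suc n q ⟨
  n * suc q  ≤⟨ *-monoʳ-≤ n q<m ⟩
  n * m      ∎
  where open ≤-Reasoning

ratio-bound : ∀ a b num den p n → 0 < p → n * den ≡ num * p → a * den < b * num → a * p < b * n
ratio-bound a b num den p n p>0 ratio ad<bn = *-cancelʳ-< den (a * p) (b * n) (begin-strict
  a * p * den    ≡⟨ x*y*z≡x*z*y a p den ⟩
  a * den * p    <⟨ *-monoˡ-< p {{>-nonZero p>0}} ad<bn ⟩
  b * num * p    ≡⟨ *-assoc b num p ⟩
  b * (num * p)  ≡⟨ cong (b *_) ratio ⟨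
  b * (n * den)  ≡⟨ *-assoc b n den ⟨
  b * n * den    ∎)
  where
  open ≤-Reasoning
  x*y*z≡x*z*y : ∀ x y z → x * y * z ≡ x * z * y
  x*y*z≡x*z*y = solve-∀

7p<4[p+e]⇒3p<4e : ∀ p e → 7 * p < 4 * (p + e) → 3 * p < 4 * e
7p<4[p+e]⇒3p<4e p e 7p<4[p+e] = +-cancelˡ-< (4 * p) (3 * p) (4 * e)
  (subst₂ _<_ (*-distribʳ-+ p 4 3) (*-distribˡ-+ 4 p e) 7p<4[p+e])

lookupW-++ˡ : ∀ u v {n} → n < length u → lookupW (u ++ v) n ≡ lookupW u n
lookupW-++ˡ (c ∷ u) v {zero}  _         = refl
lookupW-++ˡ (c ∷ u) v {suc n} (s≤s n<u) = lookupW-++ˡ u v n<u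

lookupW-++ʳ : ∀ u v n → lookupW (u ++ v) (length u + n) ≡ lookupW v n
lookupW-++ʳ []      v n = refl
lookupW-++ʳ (c ∷ u) v n = lookupW-++ʳ u v n

lookupW-reverse : ∀ x {k} → k < length x → lookupW (reverse x) (length x ∸ suc k) ≡ lookupW x k
lookupW-reverse (c ∷ x) {zero} _ = begin
  lookupW (reverse (c ∷ x)) (length x)                    ≡⟨ cong₂ lookupW (unfold-reverse c x) |x|≡|xᴿ|+0 ⟩
  lookupW (reverse x ++ c ∷ []) (length (reverse x) + 0)  ≡⟨ lookupW-++ʳ (reverse x) (c ∷ []) 0 ⟩
  c                                                       ∎
  where
  open ≡-Reasoning
  |x|≡|xᴿ|+0 : length x ≡ length (reverse x) + 0
  |x|≡|xᴿ|+0 = sym (trans (+-identityʳ _) (length-reverse x))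
lookupW-reverse (c ∷ x) {suc k} (s≤s k<x) = begin
  lookupW (reverse (c ∷ x)) (length x ∸ suc k)      ≡⟨ cong (λ u → lookupW u (length x ∸ suc k)) (unfold-reverse c x) ⟩
  lookupW (reverse x ++ c ∷ []) (length x ∸ suc k)  ≡⟨ lookupW-++ˡ (reverse x) (c ∷ []) x∸1+k<xᴿ ⟩
  lookupW (reverse x) (length x ∸ suc k)            ≡⟨ lookupW-reverse x k<x ⟩
  lookupW x k                                       ∎
  where
  open ≡-Reasoning
  x∸1+k<xᴿ : length x ∸ suc k < length (reverse x)
  x∸1+k<xᴿ = subst (length x ∸ suc k <_) (sym (length-reverse x)) (∸-monoʳ-< z<s k<x)

length-factorAt : ∀ (w : ℕ → Letter) i m → length (factorAt w i m) ≡ m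
length-factorAt w i zero    = refl
length-factorAt w i (suc m) = cong suc (length-factorAt w (suc i) m)

lookupW-factorAt : ∀ (w : ℕ → Letter) i {m k} → k < m → lookupW (factorAt w i m) k ≡ w (i + k)
lookupW-factorAt w i {suc m} {zero}  _         = cong w (sym (+-identityʳ i))
lookupW-factorAt w i {suc m} {suc k} (s≤s k<m) = trans (lookupW-factorAt w (suc i) k<m) (cong w (sym (+-suc i k)))

EqualAt : (ℕ → Letter) → ℕ → ℕ → ℕ → Set
EqualAt w i j e = ∀ {k} → k < e → w (i + k) ≡ w (j + k)

-- The factor of length e at j is the reversal of the one at i (e ∸ suc k never truncates).
ReversedAt : (ℕ → Letter) → ℕ → ℕ → ℕ → Set
ReversedAt w i j e = ∀ {k} → k < e → w (i + k) ≡ w (j + (e ∸ suc k))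

ReversedAt-shorten : ∀ {w i j e} m → m ≤ e → ReversedAt w i j e → ReversedAt w i (j + (e ∸ m)) m
ReversedAt-shorten {w} {i} {j} {e} m m≤e rev {k} k<m = trans (rev (<-≤-trans k<m m≤e)) (cong w (begin
  j + (e ∸ suc k)                ≡⟨ cong (j +_) e∸[1+k]≡ ⟩
  j + (e ∸ m + (m ∸ suc k))      ≡⟨ +-assoc j (e ∸ m) (m ∸ suc k) ⟨
  j + (e ∸ m) + (m ∸ suc k)      ∎))
  where
  open ≡-Reasoning
  e∸[1+k]≡ : e ∸ suc k ≡ e ∸ m + (m ∸ suc k)
  e∸[1+k]≡ = trans (cong (_∸ suc k) (sym (m∸n+n≡m m≤e))) (+-∸-assoc (e ∸ m) k<m)

OccursAt : (ℕ → Letter) → ℕ → Word → Set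
OccursAt w i u = factorAt w i (length u) ≡ u

OccursAt-lookupW : ∀ {w i u} → OccursAt w i u → ∀ {k} → k < length u → w (i + k) ≡ lookupW u k
OccursAt-lookupW {w} {i} occ {k} k<u = trans (sym (lookupW-factorAt w i k<u)) (cong (λ u → lookupW u k) occ)

OccursAt-prefix : ∀ {w i} x y z → OccursAt w i (x ++ y ++ z) → ∀ {k} → k < length x → w (i + k) ≡ lookupW x k
OccursAt-prefix x y z occ {k} k<x = trans (OccursAt-lookupW occ k<|xyz|) (lookupW-++ˡ x (y ++ z) k<x)
  where
  k<|xyz| : k < length (x ++ y ++ z)
  k<|xyz| = <-≤-trans k<x (subst (length x ≤_) (sym (length-++ x)) (m≤m+n (length x) (length (y ++ z))))

OccursAt-suffix : ∀ {w i} x y z → OccursAt w i (x ++ y ++ z) →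
  ∀ {n} → n < length z → w (i + length (x ++ y) + n) ≡ lookupW z n
OccursAt-suffix {w} {i} x y z occ {n} n<z = begin
  w (i + length (x ++ y) + n)                    ≡⟨ cong w (+-assoc i (length (x ++ y)) n) ⟩
  w (i + (length (x ++ y) + n))                  ≡⟨ OccursAt-lookupW occ′ xy+n<|xyz| ⟩
  lookupW ((x ++ y) ++ z) (length (x ++ y) + n)  ≡⟨ lookupW-++ʳ (x ++ y) z n ⟩
  lookupW z n                                    ∎
  where
  open ≡-Reasoning
  occ′ : OccursAt w i ((x ++ y) ++ z)
  occ′ = subst (OccursAt w i) (sym (++-assoc x y z)) occ
  xy+n<|xyz| : length (x ++ y) + n < length ((x ++ y) ++ z)
  xy+n<|xyz| = subst (length (x ++ y) + n <_) (sym (length-++ (x ++ y))) (+-monoʳ-< (length (x ++ y)) n<z)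

occurrence-of-undirected-power : ∀ {w i} x y {x′} → OccursAt w i (x ++ y ++ x′) → x′ ≡ x ⊎ x′ ≡ reverse x →
  EqualAt w i (i + length (x ++ y)) (length x) ⊎ ReversedAt w i (i + length (x ++ y)) (length x)
occurrence-of-undirected-power x y occ (inj₁ refl) =
  inj₁ λ k<x → trans (OccursAt-prefix x y x occ k<x) (sym (OccursAt-suffix x y x occ k<x))
occurrence-of-undirected-power {w} {i} x y occ (inj₂ refl) = inj₂ λ {k} k<x → begin
  w (i + k)                                         ≡⟨ OccursAt-prefix x y (reverse x) occ k<x ⟩
  lookupW x k                                       ≡⟨ lookupW-reverse x k<x ⟨
  lookupW (reverse x) (length x ∸ suc k)            ≡⟨ OccursAt-suffix x y (reverse x) occ (x∸[1+k]<|xᴿ| k<x) ⟨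
  w (i + length (x ++ y) + (length x ∸ suc k))      ∎
  where
  open ≡-Reasoning
  x∸[1+k]<|xᴿ| : ∀ {k} → k < length x → length x ∸ suc k < length (reverse x)
  x∸[1+k]<|xᴿ| {k} k<x = subst (length x ∸ suc k <_) (sym (length-reverse x)) (∸-monoʳ-< z<s k<x)

length-++-++ : ∀ (x y z : Word) → length (x ++ y ++ z) ≡ length (x ++ y) + length z
length-++-++ x y z = trans (cong length (sym (++-assoc x y z))) (length-++ (x ++ y))

length-f-letter : ∀ c → length (f-letter c) ≡ 24
length-f-letter a0 = refl
length-f-letter a1 = refl
length-f-letter a2 = refl

length-f : ∀ u → length (f u) ≡ 24 * length u
length-f []      = refl
length-f (c ∷ u) = begin
  length (f-letter c ++ f u)          ≡⟨ length-++ (f-letter c) ⟩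
  length (f-letter c) + length (f u)  ≡⟨ cong₂ _+_ (length-f-letter c) (length-f u) ⟩
  24 + 24 * length u                  ≡⟨ sym (*-suc 24 (length u)) ⟩
  24 * suc (length u)                 ∎
  where open ≡-Reasoning

lookupW-f-letter-++ : ∀ c v t → lookupW (f-letter c ++ v) (24 + t) ≡ lookupW v t
lookupW-f-letter-++ a0 v t = refl
lookupW-f-letter-++ a1 v t = refl
lookupW-f-letter-++ a2 v t = refl

lookupW-f-letter-++ˡ : ∀ c v {t} → t < 24 → lookupW (f-letter c ++ v) t ≡ lookupW (f-letter c) t
lookupW-f-letter-++ˡ c v t<24 = lookupW-++ˡ (f-letter c) v (subst (_ <_) (sym (length-f-letter c)) t<24)

lookupW-f : ∀ u {q t} → q < length u → t < 24 → lookupW (f u) (24 * q + t) ≡ lookupW (f-letter (lookupW u q)) t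
lookupW-f (c ∷ u) {zero}  _         t<24 = lookupW-f-letter-++ˡ c (f u) t<24
lookupW-f (c ∷ u) {suc q} {t} (s≤s q<u) t<24 = begin
  lookupW (f-letter c ++ f u) (24 * suc q + t)    ≡⟨ cong (lookupW (f-letter c ++ f u)) (24[1+q]+t q t) ⟩
  lookupW (f-letter c ++ f u) (24 + (24 * q + t)) ≡⟨ lookupW-f-letter-++ c (f u) (24 * q + t) ⟩
  lookupW (f u) (24 * q + t)                      ≡⟨ lookupW-f u q<u t<24 ⟩
  lookupW (f-letter (lookupW u q)) t              ∎
  where
  open ≡-Reasoning
  24[1+q]+t : ∀ q t → 24 * suc q + t ≡ 24 + (24 * q + t)
  24[1+q]+t = solve-∀

f^-head : ∀ k → ∃ λ v → f^ k (a0 ∷ []) ≡ a0 ∷ v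
f^-head zero    = [] , refl
f^-head (suc k) with f^-head k
... | v , f^k≡a0∷v = _ , cong f f^k≡a0∷v

f^-prefix : ∀ m k → ∃ λ v → f^ (m + k) (a0 ∷ []) ≡ f^ m (a0 ∷ []) ++ v
f^-prefix zero    k = f^-head k
f^-prefix (suc m) k with f^-prefix m k
... | v , f^[m+k]≡f^m++v = f v , trans (cong f f^[m+k]≡f^m++v) (concatMap-++ f-letter (f^ m (a0 ∷ [])) v)

n<length-f^n : ∀ n → n < length (f^ n (a0 ∷ []))
n<length-f^n zero    = z<s
n<length-f^n (suc n) = begin-strict
  suc n                         ≤⟨ n<length-f^n n ⟩
  length u                      <⟨ m<m*n (length u) 24 (s≤s (s≤s z≤n)) ⟩
  length u * 24                 ≡⟨ *-comm (length u) 24 ⟩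
  24 * length u                 ≡⟨ length-f u ⟨
  length (f^ (suc n) (a0 ∷ [])) ∎
  where
  open ≤-Reasoning
  u = f^ n (a0 ∷ [])
  instance
    _ : NonZero (length u)
    _ = >-nonZero (≤-<-trans z≤n (n<length-f^n n))

lookupW-f^ : ∀ N {n} → n < length (f^ N (a0 ∷ [])) → lookupW (f^ N (a0 ∷ [])) n ≡ fω0 n
lookupW-f^ N {n} n<f^N with f^-prefix N (suc n) | f^-prefix (suc n) N
... | v , f^[N+1+n]≡f^N++v | v′ , f^[1+n+N]≡f^[1+n]++v′ = begin
  lookupW (f^ N (a0 ∷ [])) n              ≡⟨ lookupW-++ˡ (f^ N (a0 ∷ [])) v n<f^N ⟨
  lookupW (f^ N (a0 ∷ []) ++ v) n         ≡⟨ cong (λ u → lookupW u n) f^[N+1+n]≡f^N++v ⟨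
  lookupW (f^ (N + suc n) (a0 ∷ [])) n    ≡⟨ cong (λ m → lookupW (f^ m (a0 ∷ [])) n) (+-comm N (suc n)) ⟩
  lookupW (f^ (suc n + N) (a0 ∷ [])) n    ≡⟨ cong (λ u → lookupW u n) f^[1+n+N]≡f^[1+n]++v′ ⟩
  lookupW (f^ (suc n) (a0 ∷ []) ++ v′) n  ≡⟨ lookupW-++ˡ (f^ (suc n) (a0 ∷ [])) v′ (<-trans (n<1+n n) (n<length-f^n (suc n))) ⟩
  fω0 n                                   ∎
  where open ≡-Reasoning

fω0-block : ∀ q {t} → t < 24 → fω0 (24 * q + t) ≡ lookupW (f-letter (fω0 q)) t
fω0-block q {t} t<24 = begin
  fω0 (24 * q + t)                             ≡⟨ lookupW-f^ (suc q) 24q+t<|f^[1+q]| ⟨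
  lookupW (f u) (24 * q + t)                   ≡⟨ lookupW-f u q<|u| t<24 ⟩
  lookupW (f-letter (lookupW u q)) t           ≡⟨ cong (λ c → lookupW (f-letter c) t) (lookupW-f^ q q<|u|) ⟩
  lookupW (f-letter (fω0 q)) t                 ∎
  where
  open ≡-Reasoning
  u = f^ q (a0 ∷ [])
  q<|u| = n<length-f^n q
  24q+t<|f^[1+q]| : 24 * q + t < length (f u)
  24q+t<|f^[1+q]| = subst (24 * q + t <_) (sym (length-f u)) (n*q+r<n*m 24 q<|u| t<24)

fω0-window : ∀ n q {m t} → m < n → t < 24 → fω0 (24 * (q + m) + t) ≡ lookupW (f (factorAt fω0 q n)) (24 * m + t)
fω0-window n q {m} {t} m<n t<24 = begin
  fω0 (24 * (q + m) + t)                               ≡⟨ fω0-block (q + m) t<24 ⟩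
  lookupW (f-letter (fω0 (q + m))) t                   ≡⟨ cong (λ c → lookupW (f-letter c) t) (lookupW-factorAt fω0 q m<n) ⟨
  lookupW (f-letter (lookupW (factorAt fω0 q n) m)) t  ≡⟨ lookupW-f (factorAt fω0 q n) m<|factor| t<24 ⟨
  lookupW (f (factorAt fω0 q n)) (24 * m + t)          ∎
  where
  open ≡-Reasoning
  m<|factor| : m < length (factorAt fω0 q n)
  m<|factor| = subst (m <_) (sym (length-factorAt fω0 q n)) m<n

fω0-view : ∀ n i {k} → k ≤ 24 * n → fω0 (i + k) ≡ lookupW (f (factorAt fω0 (i / 24) (suc n))) (i % 24 + k)
fω0-view n i {k} k≤24n = begin
  fω0 (i + k)                        ≡⟨ cong fω0 i+k≡ ⟩
  fω0 (24 * (q + j / 24) + j % 24)   ≡⟨ fω0-window (suc n) q j/24<1+n (m%n<n j 24) ⟩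
  W (24 * (j / 24) + j % 24)         ≡⟨ cong W (m≡n*[m/n]+m%n j 24) ⟨
  W j                                ∎
  where
  open ≡-Reasoning
  q = i / 24
  j = i % 24 + k
  W = lookupW (f (factorAt fω0 q (suc n)))
  j/24<1+n : j / 24 < suc n
  j/24<1+n = m<n*o⇒m/o<n (subst (j <_) (trans (sym (*-suc 24 n)) (*-comm 24 (suc n))) (+-mono-<-≤ (m%n<n i 24) k≤24n))
  distribute : ∀ q m t → 24 * q + (24 * m + t) ≡ 24 * (q + m) + t
  distribute = solve-∀
  i+k≡ : i + k ≡ 24 * (q + j / 24) + j % 24
  i+k≡ = begin
    i + k                               ≡⟨ cong (_+ k) (m≡n*[m/n]+m%n i 24) ⟩
    24 * q + i % 24 + k                 ≡⟨ +-assoc (24 * q) (i % 24) k ⟩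
    24 * q + j                          ≡⟨ cong (24 * q +_) (m≡n*[m/n]+m%n j 24) ⟩
    24 * q + (24 * (j / 24) + j % 24)   ≡⟨ distribute q (j / 24) (j % 24) ⟩
    24 * (q + j / 24) + j % 24          ∎

fω0-column-shift : ∀ i k → fω0 (i + k * 24) ≡ lookupW (f-letter (fω0 (i / 24 + k))) (i % 24)
fω0-column-shift i k = trans (cong fω0 i+k*24≡) (fω0-block (i / 24 + k) (m%n<n i 24))
  where
  regroup : ∀ q r k → 24 * q + r + k * 24 ≡ 24 * (q + k) + r
  regroup = solve-∀
  i+k*24≡ : i + k * 24 ≡ 24 * (i / 24 + k) + i % 24
  i+k*24≡ = trans (cong (_+ k * 24) (m≡n*[m/n]+m%n i 24)) (regroup (i / 24) (i % 24) k)

-- Consecutive letters of fω0 are distinct, so the decided facts below only need to range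
-- over windows f(ab) and f(abc) without equal neighbours.
image₂ : Letter → Letter → ℕ → Letter
image₂ a b = lookupW (f (a ∷ b ∷ []))

image₃ : Letter → Letter → Letter → ℕ → Letter
image₃ a b c = lookupW (f (a ∷ b ∷ c ∷ []))

f-letter-column-injective : ∀ a b {r} → r < 24 → lookupW (f-letter a) r ≡ lookupW (f-letter b) r → a ≡ b
f-letter-column-injective = from-yes (all? λ a → all? λ b → allUpTo? (λ r →
  (lookupW (f-letter a) r ≟ᴸ lookupW (f-letter b) r) →-dec (a ≟ᴸ b)) 24)

image₂-adjacent-distinct : ∀ a b → a ≢ b → ∀ {r} → r < 24 → image₂ a b r ≢ image₂ a b (suc r)
image₂-adjacent-distinct = from-yes (all? λ a → all? λ b → ¬? (a ≟ᴸ b) →-dec allUpTo? (λ r →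
  ¬? (image₂ a b r ≟ᴸ image₂ a b (suc r))) 24)

image₂-synchronising : ∀ a b c d → a ≢ b → c ≢ d → ∀ {r} → r < 24 → ∀ {s} → s < 24 →
  (∀ {k} → k < 16 → image₂ a b (r + k) ≡ image₂ c d (s + k)) → r ≡ s
image₂-synchronising = from-yes (all? λ a → all? λ b → all? λ c → all? λ d →
  ¬? (a ≟ᴸ b) →-dec ¬? (c ≟ᴸ d) →-dec allUpTo? (λ r → allUpTo? (λ s →
    allUpTo? (λ k → image₂ a b (r + k) ≟ᴸ image₂ c d (s + k)) 16 →-dec r ≟ s) 24) 24)

image₂-no-reversed-19 : ∀ a b c d → a ≢ b → c ≢ d → ∀ {r} → r < 24 → ∀ {s} → s < 24 →
  ¬ (∀ {k} → k < 19 → image₂ a b (r + k) ≡ image₂ c d (s + (19 ∸ suc k)))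
image₂-no-reversed-19 = from-yes (all? λ a → all? λ b → all? λ c → all? λ d →
  ¬? (a ≟ᴸ b) →-dec ¬? (c ≟ᴸ d) →-dec allUpTo? (λ r → allUpTo? (λ s →
    ¬? (allUpTo? (λ k → image₂ a b (r + k) ≟ᴸ image₂ c d (s + (19 ∸ suc k))) 19)) 24) 24)

image₃-no-short-repetition : ∀ a b c → a ≢ b → b ≢ c → ∀ {r} → r < 24 → ∀ {p} → p < 20 → ∀ {e} → e < 16 →
  0 < p → 3 * p < 4 * e → ¬ EqualAt (image₃ a b c) r (r + p) e
image₃-no-short-repetition = from-yes (all? λ a → all? λ b → all? λ c →
  ¬? (a ≟ᴸ b) →-dec ¬? (b ≟ᴸ c) →-dec allUpTo? (λ r → allUpTo? (λ p → allUpTo? (λ e →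
    0 <? p →-dec 3 * p <? 4 * e →-dec
    ¬? (allUpTo? (λ k → image₃ a b c (r + k) ≟ᴸ image₃ a b c (r + p + k)) e)) 16) 20) 24)

image₃-no-short-reversed-repetition : ∀ a b c → a ≢ b → b ≢ c → ∀ {r} → r < 24 → ∀ {p} → p < 24 → ∀ {e} → e < 19 →
  e ≤ p → 3 * p < 4 * e → ¬ ReversedAt (image₃ a b c) r (r + p) e
image₃-no-short-reversed-repetition = from-yes (all? λ a → all? λ b → all? λ c →
  ¬? (a ≟ᴸ b) →-dec ¬? (b ≟ᴸ c) →-dec allUpTo? (λ r → allUpTo? (λ p → allUpTo? (λ e →
    e ≤? p →-dec 3 * p <? 4 * e →-dec
    ¬? (allUpTo? (λ k → image₃ a b c (r + k) ≟ᴸ image₃ a b c (r + p + (e ∸ suc k))) e)) 19) 24) 24)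

fω0-adjacent-distinct : ∀ i → fω0 i ≢ fω0 (suc i)
fω0-adjacent-distinct = <-rec (λ i → fω0 i ≢ fω0 (suc i)) step
  where
  step : ∀ i → (∀ {j} → j < i → fω0 j ≢ fω0 (suc j)) → fω0 i ≢ fω0 (suc i)
  step zero        _   = λ ()
  step i@(suc _) rec fω0i≡fω0[1+i] = image₂-adjacent-distinct a b (rec (m/n<m i 24 (s≤s (s≤s z≤n)))) (m%n<n i 24) (begin
    image₂ a b (i % 24)        ≡⟨ cong (image₂ a b) (+-identityʳ (i % 24)) ⟨
    image₂ a b (i % 24 + 0)    ≡⟨ fω0-view 1 i z≤n ⟨
    fω0 (i + 0)                ≡⟨ cong fω0 (+-identityʳ i) ⟩
    fω0 i                      ≡⟨ fω0i≡fω0[1+i] ⟩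
    fω0 (suc i)                ≡⟨ cong fω0 (+-comm 1 i) ⟩
    fω0 (i + 1)                ≡⟨ fω0-view 1 i (s≤s z≤n) ⟩
    image₂ a b (i % 24 + 1)    ≡⟨ cong (image₂ a b) (+-comm (i % 24) 1) ⟩
    image₂ a b (suc (i % 24))  ∎)
    where
    open ≡-Reasoning
    a = fω0 (i / 24)
    b = fω0 (suc (i / 24))

fω0-synchronised : ∀ {i j} → EqualAt fω0 i j 16 → i % 24 ≡ j % 24
fω0-synchronised {i} {j} eq = image₂-synchronising _ _ _ _
  (fω0-adjacent-distinct (i / 24)) (fω0-adjacent-distinct (j / 24)) (m%n<n i 24) (m%n<n j 24) λ {k} k<16 →
  let k≤24 = ≤-trans (<⇒≤ k<16) (≤ᵇ⇒≤ 16 24 _) in begin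
    image₂ (fω0 (i / 24)) (fω0 (suc (i / 24))) (i % 24 + k)  ≡⟨ fω0-view 1 i k≤24 ⟨
    fω0 (i + k)                                              ≡⟨ eq k<16 ⟩
    fω0 (j + k)                                              ≡⟨ fω0-view 1 j k≤24 ⟩
    image₂ (fω0 (j / 24)) (fω0 (suc (j / 24))) (j % 24 + k)  ∎
  where open ≡-Reasoning

fω0-desubstitute : ∀ {i j e} → i % 24 ≡ j % 24 → EqualAt fω0 i j e → EqualAt fω0 (i / 24) (j / 24) ⌈ e / 24 ⌉
fω0-desubstitute {i} {j} i%24≡j%24 eq {k} k<⌈e/24⌉ = f-letter-column-injective _ _ (m%n<n i 24) (begin
  lookupW (f-letter (fω0 (i / 24 + k))) (i % 24)  ≡⟨ fω0-column-shift i k ⟨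
  fω0 (i + k * 24)                                ≡⟨ eq (k<⌈m/n⌉⇒k*n<m k<⌈e/24⌉) ⟩
  fω0 (j + k * 24)                                ≡⟨ fω0-column-shift j k ⟩
  lookupW (f-letter (fω0 (j / 24 + k))) (j % 24)  ≡⟨ cong (lookupW (f-letter (fω0 (j / 24 + k)))) i%24≡j%24 ⟨
  lookupW (f-letter (fω0 (j / 24 + k))) (i % 24)  ∎)
  where open ≡-Reasoning

no-short-repetition : ∀ {i p e} → 0 < p → 3 * p < 4 * e → e < 16 → ¬ EqualAt fω0 i (i + p) e
no-short-repetition {i} {p} {e} p>0 3p<4e e<16 eq = image₃-no-short-repetition a b c
  (fω0-adjacent-distinct q) (fω0-adjacent-distinct (suc q)) (m%n<n i 24) p<20 e<16 p>0 3p<4e λ {k} k<e →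
  let k≤16 = <⇒≤ (<-trans k<e e<16) in begin
    image₃ a b c (i % 24 + k)        ≡⟨ fω0-view 2 i (≤-trans k≤16 (≤ᵇ⇒≤ 16 48 _)) ⟨
    fω0 (i + k)                      ≡⟨ eq k<e ⟩
    fω0 (i + p + k)                  ≡⟨ cong fω0 (+-assoc i p k) ⟩
    fω0 (i + (p + k))                ≡⟨ fω0-view 2 i (≤-trans (+-mono-≤ (<⇒≤ p<20) k≤16) (≤ᵇ⇒≤ 36 48 _)) ⟩
    image₃ a b c (i % 24 + (p + k))  ≡⟨ cong (image₃ a b c) (+-assoc (i % 24) p k) ⟨
    image₃ a b c (i % 24 + p + k)    ∎
  where
  open ≡-Reasoning
  q = i / 24
  a = fω0 q
  b = fω0 (suc q)
  c = fω0 (suc (suc q))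
  p<20 : p < 20
  p<20 = *-cancelˡ-< 3 p 20 (<-≤-trans 3p<4e (*-monoʳ-≤ 4 (≤-pred e<16)))

fω0-repetition-descent : ∀ {i p e} → 16 ≤ e → EqualAt fω0 i (i + p) e →
  24 ∣ p × EqualAt fω0 (i / 24) (i / 24 + p / 24) ⌈ e / 24 ⌉
fω0-repetition-descent {i} {p} {e} 16≤e eq = 24∣p ,
  subst (λ j → EqualAt fω0 (i / 24) j ⌈ e / 24 ⌉) (+-distrib-/-∣ʳ i 24∣p) (fω0-desubstitute {i} {i + p} {e} synchronised eq)
  where
  synchronised : i % 24 ≡ (i + p) % 24
  synchronised = fω0-synchronised {i} {i + p} (λ k<16 → eq (<-≤-trans k<16 16≤e))
  24∣p : 24 ∣ p
  24∣p = m%d≡[m+n]%d⇒d∣n i p 24 synchronised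

no-repetition : ∀ p {i e} → 0 < p → 3 * p < 4 * e → ¬ EqualAt fω0 i (i + p) e
no-repetition = <-rec NoRepetition step
  where
  NoRepetition : ℕ → Set
  NoRepetition p = ∀ {i e} → 0 < p → 3 * p < 4 * e → ¬ EqualAt fω0 i (i + p) e
  step : ∀ p → (∀ {p′} → p′ < p → NoRepetition p′) → NoRepetition p
  step p rec {i} {e} p>0 3p<4e eq with e <? 16
  ... | yes e<16 = no-short-repetition {i} p>0 3p<4e e<16 eq
  ... | no  e≮16 = descend (fω0-repetition-descent {i} (≮⇒≥ e≮16) eq)
    where
    instance
      _ : NonZero p
      _ = >-nonZero p>0
    descend : 24 ∣ p × EqualAt fω0 (i / 24) (i / 24 + p / 24) ⌈ e / 24 ⌉ → ⊥
    descend (24∣p , eq′) = rec (m/n<m p 24 (s≤s (s≤s z≤n))) {i / 24} {⌈ e / 24 ⌉}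
      (m≥n⇒m/n>0 (∣⇒≤ 24∣p)) (a*p<b*e⇒a*[p/n]<b*⌈e/n⌉ 3 4 {p} {e} 24∣p 3p<4e) eq′

fω0-no-reversed-19 : ∀ i j → ¬ ReversedAt fω0 i j 19
fω0-no-reversed-19 i j rev = image₂-no-reversed-19 _ _ _ _
  (fω0-adjacent-distinct (i / 24)) (fω0-adjacent-distinct (j / 24)) (m%n<n i 24) (m%n<n j 24) λ {k} k<19 → begin
    image₂ (fω0 (i / 24)) (fω0 (suc (i / 24))) (i % 24 + k)             ≡⟨ fω0-view 1 i (k≤24 k<19) ⟨
    fω0 (i + k)                                                         ≡⟨ rev k<19 ⟩
    fω0 (j + (19 ∸ suc k))                                              ≡⟨ fω0-view 1 j (19∸[1+k]≤24 k) ⟩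
    image₂ (fω0 (j / 24)) (fω0 (suc (j / 24))) (j % 24 + (19 ∸ suc k))  ∎
  where
  open ≡-Reasoning
  k≤24 : ∀ {k} → k < 19 → k ≤ 24
  k≤24 k<19 = ≤-trans (<⇒≤ k<19) (≤ᵇ⇒≤ 19 24 _)
  19∸[1+k]≤24 : ∀ k → 19 ∸ suc k ≤ 24
  19∸[1+k]≤24 k = ≤-trans (m∸n≤m 19 (suc k)) (≤ᵇ⇒≤ 19 24 _)

no-short-reversed-repetition : ∀ {i p e} → e ≤ p → 3 * p < 4 * e → e < 19 → ¬ ReversedAt fω0 i (i + p) e
no-short-reversed-repetition {i} {p} {e} e≤p 3p<4e e<19 rev = image₃-no-short-reversed-repetition a b c
  (fω0-adjacent-distinct q) (fω0-adjacent-distinct (suc q)) (m%n<n i 24) p<24 e<19 e≤p 3p<4e λ {k} k<e →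
  let e′ = e ∸ suc k in begin
    image₃ a b c (i % 24 + k)         ≡⟨ fω0-view 2 i (≤-trans (<⇒≤ (<-trans k<e e<19)) (≤ᵇ⇒≤ 19 48 _)) ⟨
    fω0 (i + k)                       ≡⟨ rev k<e ⟩
    fω0 (i + p + e′)                  ≡⟨ cong fω0 (+-assoc i p e′) ⟩
    fω0 (i + (p + e′))                ≡⟨ fω0-view 2 i (≤-trans (+-mono-≤ (<⇒≤ p<24) (e′≤18 k)) (≤ᵇ⇒≤ 42 48 _)) ⟩
    image₃ a b c (i % 24 + (p + e′))  ≡⟨ cong (image₃ a b c) (+-assoc (i % 24) p e′) ⟨
    image₃ a b c (i % 24 + p + e′)    ∎
  where
  open ≡-Reasoning
  q = i / 24
  a = fω0 q
  b = fω0 (suc q)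
  c = fω0 (suc (suc q))
  p<24 : p < 24
  p<24 = *-cancelˡ-< 3 p 24 (<-≤-trans 3p<4e (*-monoʳ-≤ 4 (≤-pred e<19)))
  e′≤18 : ∀ k → e ∸ suc k ≤ 18
  e′≤18 k = ≤-trans (m∸n≤m e (suc k)) (≤-pred e<19)

no-reversed-repetition : ∀ {i p e} → e ≤ p → 3 * p < 4 * e → ¬ ReversedAt fω0 i (i + p) e
no-reversed-repetition {i} {p} {e} e≤p 3p<4e rev with e <? 19
... | yes e<19 = no-short-reversed-repetition {i} e≤p 3p<4e e<19 rev
... | no  e≮19 = fω0-no-reversed-19 i (i + p + (e ∸ 19)) (ReversedAt-shorten {fω0} {i} {i + p} {e} 19 (≮⇒≥ e≮19) rev)

theorem4 : UndirectedPlusFree fω0 7 4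
theorem4 _ num den _ 7den<4num (i , occ) (x , y , x′ , |x|>0 , x′≡x⊎xᴿ , refl , ratio) =
  [ no-repetition p {i} p>0 3p<4e , no-reversed-repetition {i} e≤p 3p<4e ]′
    (occurrence-of-undirected-power x y occ x′≡x⊎xᴿ)
  where
  p = length (x ++ y)
  e = length x
  e≤p : e ≤ p
  e≤p = subst (e ≤_) (sym (length-++ x)) (m≤m+n e (length y))
  p>0 : 0 < p
  p>0 = <-≤-trans |x|>0 e≤p
  |x′|≡e : length x′ ≡ e
  |x′|≡e = [ cong length , (λ x′≡xᴿ → trans (cong length x′≡xᴿ) (length-reverse x)) ]′ x′≡x⊎xᴿ
  |xyx′|≡p+e : length (x ++ y ++ x′) ≡ p + e
  |xyx′|≡p+e = trans (length-++-++ x y x′) (cong (p +_) |x′|≡e)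
  3p<4e : 3 * p < 4 * e
  3p<4e = 7p<4[p+e]⇒3p<4e p e (subst (λ n → 7 * p < 4 * n) |xyx′|≡p+e
    (ratio-bound 7 4 num den p (length (x ++ y ++ x′)) p>0 ratio 7den<4num))
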